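{- For every integer $h\ge1$, as formal power series in $x_1,\dots,x_h$, $$\sum_{n_1\ge\dots\ge n_h\ge1}(n_1-n_2+1)\cdots(n_{h-1}-n_h+1)\,x_1^{n_1}\cdots x_h^{n_h}=\frac{x_1\cdots x_h}{(1-x_1)^2(1-x_1x_2)^2\cdots(1-x_1\cdots x_{h-1})^2(1-x_1\cdots x_h)}.$$
   Context: For $h=1$ the product $(n_1-n_2+1)\cdots(n_{h-1}-n_h+1)$ is empty (equal to $1$) and the denominator is $1-x_1$. -}

module Defs where

open import Data.Nat using (ℕ; zero; suc; _+_; _*_; _∸_; _≤?_; _<?_)
open import Data.Nat.Properties using (_≟_)
open import Data.Bool using (Bool; true; false; if_then_else_)
open import Data.List using (List; []; _∷_; [_]; map; concatMap; upTo; foldr)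
open import Data.Nat.ListAction using (sum)
open import Data.Vec using (Vec; []; _∷_; zipWith; tabulate; replicate)
import Data.Vec.Properties as VecP
open import Data.Fin using (Fin; toℕ)
open import Relation.Nullary.Decidable using (⌊_⌋)

Exp : ℕ → Set
Exp h = Vec ℕ h

-- Formal power series in h variables with ℕ coefficients:
-- a series is its coefficient function.
FPS : ℕ → Set
FPS h = Exp h → ℕ

_==_ : ∀ {h} → Exp h → Exp h → Bool
a == b = ⌊ VecP.≡-dec _≟_ a b ⌋

box : ∀ {h} → Exp h → List (Exp h)
box []      = [ [] ]
box (k ∷ m) = concatMap (λ a → map (a ∷_) (box m)) (upTo (suc k))

_·_ : ∀ {h} → FPS h → FPS h → FPS h
(f · g) m = sum (map (λ a → f a * g (zipWith _∸_ m a)) (box m))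

mono : ∀ {h} → Exp h → FPS h
mono e m = if e == m then 1 else 0

-- The coefficient at m is the number of k with k·e = m; for e ≠ 0 any
-- such k satisfies k ≤ Σ m, so it suffices to range over k ≤ Σ m.
sumV : ∀ {h} → Exp h → ℕ
sumV []      = 0
sumV (k ∷ m) = k + sumV m

geom : ∀ {h} → Exp h → FPS h
geom e m = sum (map (λ k → if Data.Vec.map (k *_) e == m then 1 else 0) (upTo (suc (sumV m))))

prefixOnes : (h j : ℕ) → Exp h
prefixOnes h j = tabulate (λ (i : Fin h) → if ⌊ toℕ i <? j ⌋ then 1 else 0)

squaredFactors : (h : ℕ) → List (FPS h)
squaredFactors h = concatMap (λ j → geom (prefixOnes h (suc j)) ∷ geom (prefixOnes h (suc j)) ∷ []) (upTo (h ∸ 1))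

rhs : (h : ℕ) → FPS h
rhs h = foldr _·_ (mono (prefixOnes h h) · geom (prefixOnes h h)) (squaredFactors h)

-- Left-hand side: Σ_{n₁ ≥ ⋯ ≥ n_h ≥ 1} (n₁-n₂+1)⋯(n_{h-1}-n_h+1) x^n.
-- Its coefficient at n is the weight (n₁-n₂+1)⋯(n_{h-1}-n_h+1) if
-- n₁ ≥ ⋯ ≥ n_h ≥ 1, and 0 otherwise.  (Only used for h ≥ 1.)
lhs : (h : ℕ) → FPS h
lhs zero    []           = 0
lhs (suc zero) (n ∷ [])  = if ⌊ 1 ≤? n ⌋ then 1 else 0
lhs (suc (suc h)) (n ∷ n' ∷ ns) =
  if ⌊ n' ≤? n ⌋ then (n ∸ n' + 1) * lhs (suc h) (n' ∷ ns) else 0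

module Submission where

-- Write L for the left-hand side and g_j = 1/(1 - x₁⋯x_j).
-- For a series F let (diag F)(x,y,r) = [x = y]·F(y,r); iterating c times
-- gives diagⁿ c F, supported on exponents whose first c+1 entries agree.
-- Let L⁻(x,y,r) = [y ≤ x]·L(y,r) be L with its first weight removed.
-- The theorem follows by peeling the factors of the right-hand side from
-- the inside out, using three facts about coefficients:
--   (C)  x₁⋯x_h · g_h            = diagⁿ (h-1) L,
--   (A)  g_{c+1} · diagⁿ (c+1) L = diagⁿ c L⁻,
--   (B)  g_{c+1} · diagⁿ c L⁻    = diagⁿ c L      (so g_{c+1}² lowers c by one).
-- (A) and (B) reduce to c = 0 because multiplying by g_{c+1} commutes with
-- diag (geom-diagⁿ); for c = 0, g₁ takes partial sums in the first exponent
-- (geom₁-partial-sum), which gives (A) by evaluating at one point and (B)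
-- by counting.

open import Defs
open import Data.Nat using (ℕ; zero; suc; _+_; _*_; _∸_; _≤_; _<_; _≤′_; ≤′-refl; ≤′-step; z≤n; s≤s; s≤s⁻¹; _≤?_; _<?_)
open import Data.Nat.Properties
open import Algebra.Properties.CommutativeSemigroup +-commutativeSemigroup using (interchange)
open import Data.Bool using (Bool; true; false; _∧_; T; if_then_else_)
open import Data.Bool.Properties using (∧-identityʳ)
open import Data.List using (List; []; _∷_; [_]; _++_; map; concatMap; upTo; foldr)
open import Data.List.Properties using (map-cong; map-∘; map-++; map-applyUpTo; map-upTo; upTo-∷ʳ; foldr-++; concatMap-++)
open import Data.Nat.ListAction using (sum)
open import Data.Nat.ListAction.Properties using (sum-++)
open import Data.Vec using ([]; _∷_; zipWith)
import Data.Vec as Vec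
open import Data.Vec.Properties using (tabulate-cong; ≡-dec)
open import Data.Fin using (toℕ)
open import Data.Empty using (⊥-elim)
open import Data.Unit using (tt)
open import Function using (_∘_)
open import Relation.Nullary using (¬_; Dec; yes; no)
open import Relation.Nullary.Decidable using (⌊_⌋; isYes≗does; dec-true; dec-false; toWitness)
open import Relation.Binary.PropositionalEquality using (_≡_; _≢_; refl; sym; trans; cong; cong₂; subst; module ≡-Reasoning)

open ≡-Reasoning

ind : Bool → ℕ → ℕ
ind b x = if b then x else 0

ind-∧ : ∀ b c x → ind (b ∧ c) x ≡ ind b (ind c x)
ind-∧ true  c x = refl
ind-∧ false c x = refl

ind-comm : ∀ b c x → ind b (ind c x) ≡ ind c (ind b x)
ind-comm true  c     x = refl
ind-comm false true  x = refl
ind-comm false false x = refl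

ind-zero : ∀ b → ind b 0 ≡ 0
ind-zero true  = refl
ind-zero false = refl

ind-1* : ∀ b x → ind b 1 * x ≡ ind b x
ind-1* true  x = +-identityʳ x
ind-1* false x = refl

⌊⌋-true : ∀ {A : Set} (d : Dec A) → A → ⌊ d ⌋ ≡ true
⌊⌋-true d a = trans (isYes≗does d) (dec-true d a)

⌊⌋-false : ∀ {A : Set} (d : Dec A) → ¬ A → ⌊ d ⌋ ≡ false
⌊⌋-false d ¬a = trans (isYes≗does d) (dec-false d ¬a)

ind-yes : ∀ {A : Set} (d : Dec A) {x} → A → ind ⌊ d ⌋ x ≡ x
ind-yes d {x} a = cong (λ b → ind b x) (⌊⌋-true d a)

ind-no : ∀ {A : Set} (d : Dec A) {x} → ¬ A → ind ⌊ d ⌋ x ≡ 0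
ind-no d {x} ¬a = cong (λ b → ind b x) (⌊⌋-false d ¬a)

sum-cong : ∀ {A : Set} {F G : A → ℕ} → (∀ x → F x ≡ G x) → ∀ xs → sum (map F xs) ≡ sum (map G xs)
sum-cong eq xs = cong sum (map-cong eq xs)

sum-zeros : ∀ {A : Set} (xs : List A) → sum (map (λ _ → 0) xs) ≡ 0
sum-zeros []       = refl
sum-zeros (x ∷ xs) = sum-zeros xs

sum-ind : ∀ {A : Set} b (F : A → ℕ) xs → sum (map (λ x → ind b (F x)) xs) ≡ ind b (sum (map F xs))
sum-ind true  F xs = refl
sum-ind false F xs = sum-zeros xs

sum-*ʳ : ∀ {A : Set} (F : A → ℕ) c xs → sum (map F xs) * c ≡ sum (map (λ x → F x * c) xs)
sum-*ʳ F c []       = refl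
sum-*ʳ F c (x ∷ xs) = trans (*-distribʳ-+ c (F x) _) (cong (F x * c +_) (sum-*ʳ F c xs))

sum-+ : ∀ {A : Set} (F G : A → ℕ) xs → sum (map (λ x → F x + G x) xs) ≡ sum (map F xs) + sum (map G xs)
sum-+ F G []       = refl
sum-+ F G (x ∷ xs) = trans (cong (F x + G x +_) (sum-+ F G xs)) (interchange (F x) (G x) _ _)

sum-swap : ∀ {A B : Set} (g : A → B → ℕ) xs ys →
  sum (map (λ x → sum (map (g x) ys)) xs) ≡ sum (map (λ y → sum (map (λ x → g x y) xs)) ys)
sum-swap g []       ys = sym (sum-zeros ys)
sum-swap g (x ∷ xs) ys = begin
  sum (map (g x) ys) + sum (map (λ x → sum (map (g x) ys)) xs)
    ≡⟨ cong (sum (map (g x) ys) +_) (sum-swap g xs ys) ⟩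
  sum (map (g x) ys) + sum (map (λ y → sum (map (λ x → g x y) xs)) ys)
    ≡⟨ sum-+ (g x) (λ y → sum (map (λ x → g x y) xs)) ys ⟨
  sum (map (λ y → g x y + sum (map (λ x → g x y) xs)) ys) ∎

sum-concatMap : ∀ {A B : Set} (F : B → ℕ) (G : A → List B) xs →
  sum (map F (concatMap G xs)) ≡ sum (map (λ x → sum (map F (G x))) xs)
sum-concatMap F G []       = refl
sum-concatMap F G (x ∷ xs) = begin
  sum (map F (G x ++ concatMap G xs))               ≡⟨ cong sum (map-++ F (G x) (concatMap G xs)) ⟩
  sum (map F (G x) ++ map F (concatMap G xs))       ≡⟨ sum-++ (map F (G x)) _ ⟩
  sum (map F (G x)) + sum (map F (concatMap G xs))  ≡⟨ cong (sum (map F (G x)) +_) (sum-concatMap F G xs) ⟩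
  sum (map F (G x)) + sum (map (λ x → sum (map F (G x))) xs) ∎

∑ : ℕ → (ℕ → ℕ) → ℕ
∑ n F = sum (map F (upTo n))

∑-last : ∀ n (F : ℕ → ℕ) → ∑ (suc n) F ≡ ∑ n F + F n
∑-last n F = begin
  sum (map F (upTo (suc n)))       ≡⟨ cong (sum ∘ map F) (upTo-∷ʳ n) ⟨
  sum (map F (upTo n ++ [ n ]))    ≡⟨ cong sum (map-++ F (upTo n) [ n ]) ⟩
  sum (map F (upTo n) ++ [ F n ])  ≡⟨ sum-++ (map F (upTo n)) [ F n ] ⟩
  ∑ n F + (F n + 0)                ≡⟨ cong (∑ n F +_) (+-identityʳ (F n)) ⟩
  ∑ n F + F n ∎

∑-first : ∀ n (F : ℕ → ℕ) → ∑ (suc n) F ≡ F 0 + ∑ n (F ∘ suc)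
∑-first n F = cong (λ xs → F 0 + sum xs) (trans (map-applyUpTo suc F n) (sym (map-upTo (F ∘ suc) n)))

∑-cong : ∀ n {F G : ℕ → ℕ} → (∀ k → k < n → F k ≡ G k) → ∑ n F ≡ ∑ n G
∑-cong zero    eq = refl
∑-cong (suc n) {F} {G} eq = begin
  ∑ (suc n) F ≡⟨ ∑-last n F ⟩
  ∑ n F + F n ≡⟨ cong₂ _+_ (∑-cong n (λ k k<n → eq k (m<n⇒m<1+n k<n))) (eq n (n<1+n n)) ⟩
  ∑ n G + G n ≡⟨ ∑-last n G ⟨
  ∑ (suc n) G ∎

∑-zero : ∀ n {F : ℕ → ℕ} → (∀ k → k < n → F k ≡ 0) → ∑ n F ≡ 0
∑-zero zero    vanish = refl
∑-zero (suc n) {F} vanish = begin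
  ∑ (suc n) F ≡⟨ ∑-last n F ⟩
  ∑ n F + F n ≡⟨ cong₂ _+_ (∑-zero n (λ k k<n → vanish k (m<n⇒m<1+n k<n))) (vanish n (n<1+n n)) ⟩
  0 ∎

∑-extend : ∀ {s N} {F : ℕ → ℕ} → s ≤ N → (∀ k → s ≤ k → F k ≡ 0) → ∑ s F ≡ ∑ N F
∑-extend {s} {F = F} s≤N vanish = go (≤⇒≤′ s≤N)
  where
  go : ∀ {N} → s ≤′ N → ∑ s F ≡ ∑ N F
  go ≤′-refl = refl
  go (≤′-step {n} s≤′n) = begin
    ∑ s F       ≡⟨ go s≤′n ⟩
    ∑ n F       ≡⟨ +-identityʳ (∑ n F) ⟨
    ∑ n F + 0   ≡⟨ cong (∑ n F +_) (vanish n (≤′⇒≤ s≤′n)) ⟨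
    ∑ n F + F n ≡⟨ ∑-last n F ⟨
    ∑ (suc n) F ∎

∑-point : ∀ n v {F : ℕ → ℕ} → (∀ k → k ≢ v → F k ≡ 0) → ∑ (suc n) F ≡ ind ⌊ v ≤? n ⌋ (F v)
∑-point n v {F} vanish with v ≤? n
... | yes v≤n = begin
  ∑ (suc n) F ≡⟨ ∑-extend (s≤s v≤n) (λ k v<k → vanish k (λ k≡v → <-irrefl (sym k≡v) v<k)) ⟨
  ∑ (suc v) F ≡⟨ ∑-last v F ⟩
  ∑ v F + F v ≡⟨ cong (_+ F v) (∑-zero v (λ k k<v → vanish k (λ k≡v → <-irrefl k≡v k<v))) ⟩
  F v ∎
... | no v≰n = ∑-zero (suc n) (λ k k≤n → vanish k (λ k≡v → v≰n (subst (_≤ n) k≡v (s≤s⁻¹ k≤n))))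

∑-reverse : ∀ n (F : ℕ → ℕ) → ∑ (suc n) (λ k → F (n ∸ k)) ≡ ∑ (suc n) F
∑-reverse zero    F = refl
∑-reverse (suc n) F = begin
  ∑ (suc (suc n)) (λ k → F (suc n ∸ k))   ≡⟨ ∑-first (suc n) (λ k → F (suc n ∸ k)) ⟩
  F (suc n) + ∑ (suc n) (λ k → F (n ∸ k)) ≡⟨ cong (F (suc n) +_) (∑-reverse n F) ⟩
  F (suc n) + ∑ (suc n) F                 ≡⟨ +-comm (F (suc n)) _ ⟩
  ∑ (suc n) F + F (suc n)                 ≡⟨ ∑-last (suc n) F ⟨
  ∑ (suc (suc n)) F ∎

∑-count : ∀ n y L → ∑ n (λ i → ind ⌊ y ≤? i ⌋ L) ≡ (n ∸ y) * L
∑-count zero    y L = cong (_* L) (sym (0∸n≡0 y))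
∑-count (suc n) y L = begin
  ∑ (suc n) (λ i → ind ⌊ y ≤? i ⌋ L)          ≡⟨ ∑-last n _ ⟩
  ∑ n (λ i → ind ⌊ y ≤? i ⌋ L) + ind ⌊ y ≤? n ⌋ L ≡⟨ cong (_+ ind ⌊ y ≤? n ⌋ L) (∑-count n y L) ⟩
  (n ∸ y) * L + ind ⌊ y ≤? n ⌋ L              ≡⟨ last-term ⟩
  (suc n ∸ y) * L ∎
  where
  last-term : (n ∸ y) * L + ind ⌊ y ≤? n ⌋ L ≡ (suc n ∸ y) * L
  last-term with y ≤? n
  ... | yes y≤n = trans (+-comm _ L) (cong (_* L) (sym (+-∸-assoc 1 y≤n)))
  ... | no y≰n  = trans (+-identityʳ _)
                    (cong (_* L) (trans (m≤n⇒m∸n≡0 (<⇒≤ (≰⇒> y≰n))) (sym (m≤n⇒m∸n≡0 (≰⇒> y≰n)))))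

infix  20 _⊑_
infixl 25 _∸ᵛ_
infixr 25 _*ᵛ_

_⊑_ : ∀ {h} → Exp h → Exp h → Bool
[]      ⊑ []      = true
(x ∷ a) ⊑ (y ∷ m) = ⌊ x ≤? y ⌋ ∧ (a ⊑ m)

_∸ᵛ_ : ∀ {h} → Exp h → Exp h → Exp h
m ∸ᵛ a = zipWith _∸_ m a

_*ᵛ_ : ∀ {h} → ℕ → Exp h → Exp h
k *ᵛ e = Vec.map (k *_) e

==-∷ : ∀ {h} x y (a b : Exp h) → ((x ∷ a) == (y ∷ b)) ≡ ⌊ x ≟ y ⌋ ∧ (a == b)
==-∷ x y a b = trans (isYes≗does (≡-dec _≟_ (x ∷ a) (y ∷ b)))
                     (sym (cong₂ _∧_ (isYes≗does (x ≟ y)) (isYes≗does (≡-dec _≟_ a b))))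

==-sound : ∀ {h} {a b : Exp h} → (a == b) ≡ true → a ≡ b
==-sound a==b = toWitness (subst T (sym a==b) tt)

⊑-sumV : ∀ {h} (a m : Exp h) → a ⊑ m ≡ true → sumV a ≤ sumV m
⊑-sumV []      []      _   = z≤n
⊑-sumV (x ∷ a) (y ∷ m) a⊑m with x ≤? y
... | yes x≤y = +-mono-≤ x≤y (⊑-sumV a m a⊑m)

sumV-*ᵛ : ∀ {h} k (e : Exp h) → sumV (k *ᵛ e) ≡ k * sumV e
sumV-*ᵛ k []      = sym (*-zeroʳ k)
sumV-*ᵛ k (x ∷ e) = trans (cong (k * x +_) (sumV-*ᵛ k e)) (sym (*-distribˡ-+ k x (sumV e)))

sum-box-∷ : ∀ {h} k (m : Exp h) (F : Exp (suc h) → ℕ) →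
  sum (map F (box (k ∷ m))) ≡ ∑ (suc k) (λ a₀ → sum (map (λ a → F (a₀ ∷ a)) (box m)))
sum-box-∷ k m F = trans (sum-concatMap F (λ a₀ → map (a₀ ∷_) (box m)) (upTo (suc k)))
                        (sum-cong (λ a₀ → cong sum (sym (map-∘ {g = F} {f = a₀ ∷_} (box m)))) (upTo (suc k)))

box-cong : ∀ {h} (m : Exp h) {F G : Exp h → ℕ} → (∀ a → a ⊑ m ≡ true → F a ≡ G a) →
  sum (map F (box m)) ≡ sum (map G (box m))
box-cong []      eq = cong (_+ 0) (eq [] refl)
box-cong (k ∷ m) {F} {G} eq = begin
  sum (map F (box (k ∷ m)))                                 ≡⟨ sum-box-∷ k m F ⟩
  ∑ (suc k) (λ a₀ → sum (map (λ a → F (a₀ ∷ a)) (box m)))  ≡⟨ ∑-cong (suc k) row ⟩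
  ∑ (suc k) (λ a₀ → sum (map (λ a → G (a₀ ∷ a)) (box m)))  ≡⟨ sum-box-∷ k m G ⟨
  sum (map G (box (k ∷ m))) ∎
  where
  row : ∀ a₀ → a₀ < suc k → sum (map (λ a → F (a₀ ∷ a)) (box m)) ≡ sum (map (λ a → G (a₀ ∷ a)) (box m))
  row a₀ a₀≤k = box-cong m (λ a a⊑m → eq (a₀ ∷ a)
    (trans (cong (_∧ (a ⊑ m)) (⌊⌋-true (a₀ ≤? k) (s≤s⁻¹ a₀≤k))) a⊑m))

box-point : ∀ {h} (m v : Exp h) (G : Exp h → ℕ) →
  sum (map (λ a → ind (v == a) (G a)) (box m)) ≡ ind (v ⊑ m) (G v)
box-point []      []       G = +-identityʳ (G [])
box-point (k ∷ m) (v₀ ∷ v) G = begin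
  sum (map (λ a → ind ((v₀ ∷ v) == a) (G a)) (box (k ∷ m)))
    ≡⟨ sum-box-∷ k m _ ⟩
  ∑ (suc k) (λ a₀ → sum (map (λ a → ind ((v₀ ∷ v) == (a₀ ∷ a)) (G (a₀ ∷ a))) (box m)))
    ≡⟨ sum-cong row (upTo (suc k)) ⟩
  ∑ (suc k) (λ a₀ → ind ⌊ v₀ ≟ a₀ ⌋ (ind (v ⊑ m) (G (a₀ ∷ v))))
    ≡⟨ ∑-point k v₀ (λ a₀ a₀≢v₀ → ind-no (v₀ ≟ a₀) (a₀≢v₀ ∘ sym)) ⟩
  ind ⌊ v₀ ≤? k ⌋ (ind ⌊ v₀ ≟ v₀ ⌋ (ind (v ⊑ m) (G (v₀ ∷ v))))
    ≡⟨ cong (ind ⌊ v₀ ≤? k ⌋) (ind-yes (v₀ ≟ v₀) refl) ⟩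
  ind ⌊ v₀ ≤? k ⌋ (ind (v ⊑ m) (G (v₀ ∷ v)))
    ≡⟨ ind-∧ ⌊ v₀ ≤? k ⌋ (v ⊑ m) _ ⟨
  ind ((v₀ ∷ v) ⊑ (k ∷ m)) (G (v₀ ∷ v)) ∎
  where
  row : ∀ a₀ → sum (map (λ a → ind ((v₀ ∷ v) == (a₀ ∷ a)) (G (a₀ ∷ a))) (box m))
             ≡ ind ⌊ v₀ ≟ a₀ ⌋ (ind (v ⊑ m) (G (a₀ ∷ v)))
  row a₀ = begin
    sum (map (λ a → ind ((v₀ ∷ v) == (a₀ ∷ a)) (G (a₀ ∷ a))) (box m))
      ≡⟨ sum-cong (λ a → trans (cong (λ b → ind b (G (a₀ ∷ a))) (==-∷ v₀ a₀ v a))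
                                   (ind-∧ ⌊ v₀ ≟ a₀ ⌋ (v == a) (G (a₀ ∷ a)))) (box m) ⟩
    sum (map (λ a → ind ⌊ v₀ ≟ a₀ ⌋ (ind (v == a) (G (a₀ ∷ a)))) (box m))
      ≡⟨ sum-ind ⌊ v₀ ≟ a₀ ⌋ _ (box m) ⟩
    ind ⌊ v₀ ≟ a₀ ⌋ (sum (map (λ a → ind (v == a) (G (a₀ ∷ a))) (box m)))
      ≡⟨ cong (ind ⌊ v₀ ≟ a₀ ⌋) (box-point m v (λ a → G (a₀ ∷ a))) ⟩
    ind ⌊ v₀ ≟ a₀ ⌋ (ind (v ⊑ m) (G (a₀ ∷ v))) ∎

·-congʳ : ∀ {h} (g : FPS h) {F G : FPS h} → (∀ a → F a ≡ G a) → ∀ m → (g · F) m ≡ (g · G) m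
·-congʳ g eq m = sum-cong (λ a → cong (g a *_) (eq (m ∸ᵛ a))) (box m)

shiftBy : ∀ {h} → Exp h → FPS h → FPS h
shiftBy e f m = ind (e ⊑ m) (f (m ∸ᵛ e))

mono-mul : ∀ {h} (e : Exp h) (f : FPS h) m → (mono e · f) m ≡ shiftBy e f m
mono-mul e f m = trans (sum-cong (λ a → ind-1* (e == a) (f (m ∸ᵛ a))) (box m)) (box-point m e (λ a → f (m ∸ᵛ a)))

geom-expand : ∀ {h} (e a : Exp h) N → 1 ≤ sumV e → sumV a ≤ N →
  geom e a ≡ ∑ (suc N) (λ k → ind (k *ᵛ e == a) 1)
geom-expand e a N e≢0 a≤N = ∑-extend (s≤s a≤N) vanish
  where
  k≤|ke| : ∀ k → k ≤ sumV (k *ᵛ e)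
  k≤|ke| k = subst (k ≤_) (sym (sumV-*ᵛ k e)) (subst (_≤ k * sumV e) (*-identityʳ k) (*-monoʳ-≤ k e≢0))
  vanish : ∀ k → suc (sumV a) ≤ k → ind (k *ᵛ e == a) 1 ≡ 0
  vanish k |a|<k with k *ᵛ e == a in ke==a
  ... | false = refl
  ... | true  = ⊥-elim (<⇒≱ |a|<k (subst (λ v → k ≤ sumV v) (==-sound ke==a) (k≤|ke| k)))

geom-mul : ∀ {h} (e : Exp h) (f : FPS h) m N → 1 ≤ sumV e → sumV m ≤ N →
  (geom e · f) m ≡ ∑ (suc N) (λ k → shiftBy (k *ᵛ e) f m)
geom-mul e f m N e≢0 m≤N = begin
  sum (map (λ a → geom e a * f (m ∸ᵛ a)) (box m))
    ≡⟨ box-cong m (λ a a⊑m → cong (_* f (m ∸ᵛ a)) (geom-expand e a N e≢0 (≤-trans (⊑-sumV a m a⊑m) m≤N))) ⟩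
  sum (map (λ a → ∑ (suc N) (λ k → ind (k *ᵛ e == a) 1) * f (m ∸ᵛ a)) (box m))
    ≡⟨ sum-cong (λ a → trans (sum-*ʳ (λ k → ind (k *ᵛ e == a) 1) (f (m ∸ᵛ a)) (upTo (suc N)))
                             (sum-cong (λ k → ind-1* (k *ᵛ e == a) (f (m ∸ᵛ a))) (upTo (suc N)))) (box m) ⟩
  sum (map (λ a → ∑ (suc N) (λ k → ind (k *ᵛ e == a) (f (m ∸ᵛ a)))) (box m))
    ≡⟨ sum-swap (λ a k → ind (k *ᵛ e == a) (f (m ∸ᵛ a))) (box m) (upTo (suc N)) ⟩
  ∑ (suc N) (λ k → sum (map (λ a → ind (k *ᵛ e == a) (f (m ∸ᵛ a))) (box m)))
    ≡⟨ sum-cong (λ k → box-point m (k *ᵛ e) (λ a → f (m ∸ᵛ a))) (upTo (suc N)) ⟩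
  ∑ (suc N) (λ k → shiftBy (k *ᵛ e) f m) ∎

geom-head-one : ∀ {h} (e : Exp h) x w → geom (1 ∷ e) (x ∷ w) ≡ ind (x *ᵛ e == w) 1
geom-head-one e x w = begin
  ∑ (suc (x + sumV w)) (λ k → ind ((k * 1 ∷ k *ᵛ e) == (x ∷ w)) 1)
    ≡⟨ sum-cong (λ k → trans (cong (λ b → ind b 1) (==-∷ (k * 1) x (k *ᵛ e) w))
                             (ind-∧ ⌊ k * 1 ≟ x ⌋ (k *ᵛ e == w) 1)) (upTo (suc (x + sumV w))) ⟩
  ∑ (suc (x + sumV w)) (λ k → ind ⌊ k * 1 ≟ x ⌋ (ind (k *ᵛ e == w) 1))
    ≡⟨ ∑-point (x + sumV w) x (λ k k≢x → ind-no (k * 1 ≟ x) (k≢x ∘ trans (sym (*-identityʳ k)))) ⟩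
  ind ⌊ x ≤? x + sumV w ⌋ (ind ⌊ x * 1 ≟ x ⌋ (ind (x *ᵛ e == w) 1))
    ≡⟨ trans (ind-yes (x ≤? x + sumV w) (m≤m+n x _)) (ind-yes (x * 1 ≟ x) (*-identityʳ x)) ⟩
  ind (x *ᵛ e == w) 1 ∎

prefix : (h j : ℕ) → Exp h
prefix zero    j       = []
prefix (suc h) zero    = 0 ∷ prefix h zero
prefix (suc h) (suc j) = 1 ∷ prefix h j

prefixOnes≡prefix : ∀ h j → prefixOnes h j ≡ prefix h j
prefixOnes≡prefix zero    j       = refl
prefixOnes≡prefix (suc h) zero    = cong (0 ∷_) (prefixOnes≡prefix h zero)
prefixOnes≡prefix (suc h) (suc j) =
  cong (1 ∷_) (trans (tabulate-cong (λ i → cong (λ b → if b then 1 else 0) (<?-suc (toℕ i))))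
                     (prefixOnes≡prefix h j))
  where
  <?-suc : ∀ t → ⌊ suc t <? suc j ⌋ ≡ ⌊ t <? j ⌋
  <?-suc t = trans (isYes≗does (suc t <? suc j)) (sym (isYes≗does (t <? j)))

*ᵛ-prefix0 : ∀ h k → k *ᵛ prefix h 0 ≡ prefix h 0
*ᵛ-prefix0 zero    k = refl
*ᵛ-prefix0 (suc h) k = cong₂ _∷_ (*-zeroʳ k) (*ᵛ-prefix0 h k)

prefix0-⊑ : ∀ {h} (w : Exp h) → prefix h 0 ⊑ w ≡ true
prefix0-⊑ []      = refl
prefix0-⊑ (y ∷ w) = prefix0-⊑ w

∸ᵛ-prefix0 : ∀ {h} (w : Exp h) → w ∸ᵛ prefix h 0 ≡ w
∸ᵛ-prefix0 []      = refl
∸ᵛ-prefix0 (y ∷ w) = cong (y ∷_) (∸ᵛ-prefix0 w)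

shift-first : ∀ {h} k (F : FPS (suc h)) x w →
  shiftBy (k *ᵛ prefix (suc h) 1) F (x ∷ w) ≡ ind ⌊ k ≤? x ⌋ (F (x ∸ k ∷ w))
shift-first {h} k F x w
  rewrite *-identityʳ k | *ᵛ-prefix0 h k | prefix0-⊑ w | ∸ᵛ-prefix0 w | ∧-identityʳ ⌊ k ≤? x ⌋ = refl

geom₁-partial-sum : ∀ {h} (F : FPS (suc h)) x w →
  (geom (prefix (suc h) 1) · F) (x ∷ w) ≡ ∑ (suc x) (λ i → F (i ∷ w))
geom₁-partial-sum F x w = begin
  (geom (prefix _ 1) · F) (x ∷ w)
    ≡⟨ geom-mul (prefix _ 1) F (x ∷ w) N (s≤s z≤n) ≤-refl ⟩
  ∑ (suc N) (λ k → shiftBy (k *ᵛ prefix _ 1) F (x ∷ w))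
    ≡⟨ sum-cong (λ k → shift-first k F x w) (upTo (suc N)) ⟩
  ∑ (suc N) (λ k → ind ⌊ k ≤? x ⌋ (F (x ∸ k ∷ w)))
    ≡⟨ ∑-extend (s≤s (m≤m+n x (sumV w))) (λ k x<k → ind-no (k ≤? x) (<⇒≱ x<k)) ⟨
  ∑ (suc x) (λ k → ind ⌊ k ≤? x ⌋ (F (x ∸ k ∷ w)))
    ≡⟨ ∑-cong (suc x) (λ k k≤x → ind-yes (k ≤? x) (s≤s⁻¹ k≤x)) ⟩
  ∑ (suc x) (λ k → F (x ∸ k ∷ w))
    ≡⟨ ∑-reverse x (λ i → F (i ∷ w)) ⟩
  ∑ (suc x) (λ i → F (i ∷ w)) ∎
  where
  N = x + sumV w

Family : Set
Family = ∀ {h} → FPS h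

diag : Family → Family
diag F []          = 0
diag F (x ∷ [])    = 0
diag F (x ∷ y ∷ r) = ind ⌊ x ≟ y ⌋ (F (y ∷ r))

diagⁿ : ℕ → Family → Family
diagⁿ zero    F = F
diagⁿ (suc c) F = diag (diagⁿ c F)

diag-cong : {F G : Family} → (∀ {h} (m : Exp h) → F m ≡ G m) → ∀ {h} (m : Exp h) → diag F m ≡ diag G m
diag-cong eq []          = refl
diag-cong eq (x ∷ [])    = refl
diag-cong eq (x ∷ y ∷ r) = cong (ind ⌊ x ≟ y ⌋) (eq (y ∷ r))

diagⁿ-diag : ∀ c {F : Family} {h} (m : Exp h) → diagⁿ c (diag F) m ≡ diagⁿ (suc c) F m
diagⁿ-diag zero    m = refl
diagⁿ-diag (suc c) m = diag-cong (diagⁿ-diag c) m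

shift-diag : ∀ {h} (G : Family) a (e : Exp h) x y r →
  shiftBy (a ∷ a ∷ e) (diag G) (x ∷ y ∷ r) ≡ ind ⌊ x ≟ y ⌋ (shiftBy (a ∷ e) G (y ∷ r))
shift-diag G a e x y r with x ≟ y
... | yes refl with a ≤? x
...   | yes _ = cong (ind (e ⊑ r)) (ind-yes (x ∸ a ≟ x ∸ a) refl)
...   | no  _ = refl
shift-diag G a e x y r | no x≢y with a ≤? x | a ≤? y
...   | yes a≤x | yes a≤y = trans (cong (ind (e ⊑ r)) (ind-no (x ∸ a ≟ y ∸ a) (x≢y ∘ ∸-cancelʳ-≡ a≤x a≤y)))
                                  (ind-zero (e ⊑ r))
...   | yes _   | no  _   = refl
...   | no  _   | _       = refl

geom-diag : ∀ {h} (G : Family) (e : Exp h) x y r →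
  (geom (1 ∷ 1 ∷ e) · diag G) (x ∷ y ∷ r) ≡ ind ⌊ x ≟ y ⌋ ((geom (1 ∷ e) · G) (y ∷ r))
geom-diag G e x y r = begin
  (geom (1 ∷ 1 ∷ e) · diag G) (x ∷ y ∷ r)
    ≡⟨ geom-mul (1 ∷ 1 ∷ e) (diag G) (x ∷ y ∷ r) N (s≤s z≤n) ≤-refl ⟩
  ∑ (suc N) (λ k → shiftBy (k *ᵛ (1 ∷ 1 ∷ e)) (diag G) (x ∷ y ∷ r))
    ≡⟨ sum-cong (λ k → shift-diag G (k * 1) (k *ᵛ e) x y r) (upTo (suc N)) ⟩
  ∑ (suc N) (λ k → ind ⌊ x ≟ y ⌋ (shiftBy (k *ᵛ (1 ∷ e)) G (y ∷ r)))
    ≡⟨ sum-ind ⌊ x ≟ y ⌋ (λ k → shiftBy (k *ᵛ (1 ∷ e)) G (y ∷ r)) (upTo (suc N)) ⟩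
  ind ⌊ x ≟ y ⌋ (∑ (suc N) (λ k → shiftBy (k *ᵛ (1 ∷ e)) G (y ∷ r)))
    ≡⟨ cong (ind ⌊ x ≟ y ⌋) (geom-mul (1 ∷ e) G (y ∷ r) N (s≤s z≤n) (m≤n+m _ x)) ⟨
  ind ⌊ x ≟ y ⌋ ((geom (1 ∷ e) · G) (y ∷ r)) ∎
  where
  N = sumV (x ∷ y ∷ r)

geom-diagⁿ : (F F' : Family) → (∀ {h} (m : Exp (suc (suc h))) → (geom (prefix _ 1) · F) m ≡ F' m) →
  ∀ c {h} (m : Exp h) → suc c < h → (geom (prefix h (suc c)) · diagⁿ c F) m ≡ diagⁿ c F' m
geom-diagⁿ F F' base c       []          ()
geom-diagⁿ F F' base c       (x ∷ [])    (s≤s ())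
geom-diagⁿ F F' base zero    (x ∷ y ∷ r) _ = base (x ∷ y ∷ r)
geom-diagⁿ F F' base (suc c) (x ∷ y ∷ r) (s≤s c+1<h) = begin
  (geom (1 ∷ 1 ∷ prefix _ c) · diag (diagⁿ c F)) (x ∷ y ∷ r)
    ≡⟨ geom-diag (diagⁿ c F) (prefix _ c) x y r ⟩
  ind ⌊ x ≟ y ⌋ ((geom (prefix _ (suc c)) · diagⁿ c F) (y ∷ r))
    ≡⟨ cong (ind ⌊ x ≟ y ⌋) (geom-diagⁿ F F' base c (y ∷ r) c+1<h) ⟩
  diagⁿ (suc c) F' (x ∷ y ∷ r) ∎

L : Family
L {h} = lhs h

L⁻ : Family
L⁻ []          = 0
L⁻ (x ∷ [])    = 0
L⁻ (x ∷ y ∷ r) = ind ⌊ y ≤? x ⌋ (L (y ∷ r))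

-- (A) for c = 0: partial sums of [x = y]·L(y, r) in x give L⁻.
geom₁-diagL : ∀ {h} (m : Exp (suc (suc h))) → (geom (prefix _ 1) · diag L) m ≡ L⁻ m
geom₁-diagL (x ∷ y ∷ r) = begin
  (geom (prefix _ 1) · diag L) (x ∷ y ∷ r)      ≡⟨ geom₁-partial-sum (diag L) x (y ∷ r) ⟩
  ∑ (suc x) (λ i → ind ⌊ i ≟ y ⌋ (L (y ∷ r)))   ≡⟨ ∑-point x y (λ i i≢y → ind-no (i ≟ y) i≢y) ⟩
  ind ⌊ y ≤? x ⌋ (ind ⌊ y ≟ y ⌋ (L (y ∷ r)))    ≡⟨ cong (ind ⌊ y ≤? x ⌋) (ind-yes (y ≟ y) refl) ⟩
  L⁻ (x ∷ y ∷ r) ∎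

-- (B) for c = 0: partial sums of L⁻ in x count the x' ≤ x with y ≤ x',
-- which restores the weight x - y + 1.
geom₁-L⁻ : ∀ {h} (m : Exp (suc (suc h))) → (geom (prefix _ 1) · L⁻) m ≡ L m
geom₁-L⁻ (x ∷ y ∷ r) = begin
  (geom (prefix _ 1) · L⁻) (x ∷ y ∷ r)         ≡⟨ geom₁-partial-sum L⁻ x (y ∷ r) ⟩
  ∑ (suc x) (λ i → ind ⌊ y ≤? i ⌋ (L (y ∷ r)))  ≡⟨ ∑-count (suc x) y (L (y ∷ r)) ⟩
  (suc x ∸ y) * L (y ∷ r)                       ≡⟨ weight ⟩
  L (x ∷ y ∷ r) ∎
  where
  weight : (suc x ∸ y) * L (y ∷ r) ≡ ind ⌊ y ≤? x ⌋ ((x ∸ y + 1) * L (y ∷ r))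
  weight with y ≤? x
  ... | yes y≤x = cong (_* L (y ∷ r)) (trans (+-∸-assoc 1 y≤x) (+-comm 1 (x ∸ y)))
  ... | no  y≰x = cong (_* L (y ∷ r)) (m≤n⇒m∸n≡0 (≰⇒> y≰x))

shift-multiple-coord : ∀ a b c X → ind ⌊ a ≤? b ⌋ (ind ⌊ c * a ≟ b ∸ a ⌋ X) ≡ ind ⌊ suc c * a ≟ b ⌋ X
shift-multiple-coord a b c X with a ≤? b
... | no a≰b = sym (ind-no (suc c * a ≟ b) (λ eq → a≰b (subst (a ≤_) eq (m≤m+n a (c * a)))))
... | yes a≤b with c * a ≟ b ∸ a
...   | yes eq  = sym (ind-yes (suc c * a ≟ b) (trans (cong (a +_) eq) (m+[n∸m]≡n a≤b)))
...   | no  neq = sym (ind-no (suc c * a ≟ b) (λ eq → neq (trans (sym (m+n∸m≡n a (c * a))) (cong (_∸ a) eq))))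

shift-multiple : ∀ {h} c (e w : Exp h) → ind (e ⊑ w) (ind (c *ᵛ e == w ∸ᵛ e) 1) ≡ ind (suc c *ᵛ e == w) 1
shift-multiple c []      []      = refl
shift-multiple c (a ∷ e) (b ∷ w) = begin
  ind (⌊ a ≤? b ⌋ ∧ (e ⊑ w)) (ind ((c * a ∷ c *ᵛ e) == (b ∸ a ∷ w ∸ᵛ e)) 1)
    ≡⟨ cong (λ t → ind (⌊ a ≤? b ⌋ ∧ (e ⊑ w)) (ind t 1)) (==-∷ (c * a) (b ∸ a) (c *ᵛ e) (w ∸ᵛ e)) ⟩
  ind (⌊ a ≤? b ⌋ ∧ (e ⊑ w)) (ind (⌊ c * a ≟ b ∸ a ⌋ ∧ (c *ᵛ e == w ∸ᵛ e)) 1)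
    ≡⟨ trans (ind-∧ ⌊ a ≤? b ⌋ (e ⊑ w) _) (cong (ind ⌊ a ≤? b ⌋ ∘ ind (e ⊑ w)) (ind-∧ ⌊ c * a ≟ b ∸ a ⌋ _ 1)) ⟩
  ind ⌊ a ≤? b ⌋ (ind (e ⊑ w) (ind ⌊ c * a ≟ b ∸ a ⌋ (ind (c *ᵛ e == w ∸ᵛ e) 1)))
    ≡⟨ cong (ind ⌊ a ≤? b ⌋) (ind-comm (e ⊑ w) ⌊ c * a ≟ b ∸ a ⌋ _) ⟩
  ind ⌊ a ≤? b ⌋ (ind ⌊ c * a ≟ b ∸ a ⌋ (ind (e ⊑ w) (ind (c *ᵛ e == w ∸ᵛ e) 1)))
    ≡⟨ cong (ind ⌊ a ≤? b ⌋ ∘ ind ⌊ c * a ≟ b ∸ a ⌋) (shift-multiple c e w) ⟩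
  ind ⌊ a ≤? b ⌋ (ind ⌊ c * a ≟ b ∸ a ⌋ (ind (suc c *ᵛ e == w) 1))
    ≡⟨ shift-multiple-coord a b c _ ⟩
  ind ⌊ suc c * a ≟ b ⌋ (ind (suc c *ᵛ e == w) 1)
    ≡⟨ ind-∧ ⌊ suc c * a ≟ b ⌋ (suc c *ᵛ e == w) 1 ⟨
  ind (⌊ suc c * a ≟ b ⌋ ∧ (suc c *ᵛ e == w)) 1
    ≡⟨ cong (λ t → ind t 1) (==-∷ (suc c * a) b (suc c *ᵛ e) w) ⟨
  ind (suc c *ᵛ (a ∷ e) == (b ∷ w)) 1 ∎

diagⁿ-constant : ∀ n (F : Family) x (w : Exp n) → diagⁿ n F (x ∷ w) ≡ ind (x *ᵛ prefix n n == w) (F (x ∷ []))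
diagⁿ-constant zero    F x []      = refl
diagⁿ-constant (suc n) F x (y ∷ w) = begin
  ind ⌊ x ≟ y ⌋ (diagⁿ n F (y ∷ w))
    ≡⟨ cong (ind ⌊ x ≟ y ⌋) (diagⁿ-constant n F y w) ⟩
  ind ⌊ x ≟ y ⌋ (ind (y *ᵛ prefix n n == w) (F (y ∷ [])))
    ≡⟨ first-entry ⟩
  ind ⌊ x * 1 ≟ y ⌋ (ind (x *ᵛ prefix n n == w) (F (x ∷ [])))
    ≡⟨ ind-∧ ⌊ x * 1 ≟ y ⌋ (x *ᵛ prefix n n == w) (F (x ∷ [])) ⟨
  ind (⌊ x * 1 ≟ y ⌋ ∧ (x *ᵛ prefix n n == w)) (F (x ∷ []))
    ≡⟨ cong (λ t → ind t (F (x ∷ []))) (==-∷ (x * 1) y (x *ᵛ prefix n n) w) ⟨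
  ind (x *ᵛ prefix (suc n) (suc n) == (y ∷ w)) (F (x ∷ [])) ∎
  where
  first-entry : ind ⌊ x ≟ y ⌋ (ind (y *ᵛ prefix n n == w) (F (y ∷ [])))
              ≡ ind ⌊ x * 1 ≟ y ⌋ (ind (x *ᵛ prefix n n == w) (F (x ∷ [])))
  first-entry with x ≟ y
  ... | yes refl = sym (ind-yes (x * 1 ≟ x) (*-identityʳ x))
  ... | no  x≢y  = sym (ind-no (x * 1 ≟ y) (x≢y ∘ trans (sym (*-identityʳ x))))

-- (C): x₁⋯x_h · 1/(1 - x₁⋯x_h) = diagⁿ (h-1) L, i.e. its coefficient at
-- n is 1 exactly when n₁ = ⋯ = n_h ≥ 1.
innermost : ∀ n (m : Exp (suc n)) →
  (mono (prefix (suc n) (suc n)) · geom (prefix (suc n) (suc n))) m ≡ diagⁿ n L m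
innermost n (x ∷ w) = begin
  (mono (1 ∷ o) · geom (1 ∷ o)) (x ∷ w)
    ≡⟨ mono-mul (1 ∷ o) (geom (1 ∷ o)) (x ∷ w) ⟩
  ind (⌊ 1 ≤? x ⌋ ∧ (o ⊑ w)) (geom (1 ∷ o) (x ∸ 1 ∷ w ∸ᵛ o))
    ≡⟨ cong (ind (⌊ 1 ≤? x ⌋ ∧ (o ⊑ w))) (geom-head-one o (x ∸ 1) (w ∸ᵛ o)) ⟩
  ind (⌊ 1 ≤? x ⌋ ∧ (o ⊑ w)) (ind ((x ∸ 1) *ᵛ o == w ∸ᵛ o) 1)
    ≡⟨ shifted x ⟩
  ind (x *ᵛ o == w) (L (x ∷ []))
    ≡⟨ diagⁿ-constant n L x w ⟨
  diagⁿ n L (x ∷ w) ∎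
  where
  o = prefix n n
  shifted : ∀ x → ind (⌊ 1 ≤? x ⌋ ∧ (o ⊑ w)) (ind ((x ∸ 1) *ᵛ o == w ∸ᵛ o) 1) ≡ ind (x *ᵛ o == w) (L (x ∷ []))
  shifted zero    = sym (ind-zero (0 *ᵛ o == w))
  shifted (suc c) = shift-multiple c o w

-- (A) then (B): the squared factor 1/(1 - x₁⋯x_{c+1})² maps diagⁿ (c+1) L
-- to diagⁿ c L.
squared-factor : ∀ {h} c → suc c < h → (b : FPS h) → (∀ m → b m ≡ diagⁿ (suc c) L m) →
  ∀ m → (geom (prefixOnes h (suc c)) · (geom (prefixOnes h (suc c)) · b)) m ≡ diagⁿ c L m
squared-factor {h} c c+1<h b b≈ m = begin
  (geom (prefixOnes h (suc c)) · (geom (prefixOnes h (suc c)) · b)) m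
    ≡⟨ cong (λ v → (geom v · (geom v · b)) m) (prefixOnes≡prefix h (suc c)) ⟩
  (g · (g · b)) m
    ≡⟨ ·-congʳ g (λ a → trans (·-congʳ g (λ a′ → trans (b≈ a′) (sym (diagⁿ-diag c a′))) a)
                              (geom-diagⁿ (diag L) L⁻ geom₁-diagL c a c+1<h)) m ⟩
  (g · diagⁿ c L⁻) m
    ≡⟨ geom-diagⁿ L⁻ L geom₁-L⁻ c m c+1<h ⟩
  diagⁿ c L m ∎
  where
  g = geom (prefix h (suc c))

squared : ∀ h → ℕ → List (FPS h)
squared h j = geom (prefixOnes h (suc j)) ∷ geom (prefixOnes h (suc j)) ∷ []

telescope : ∀ {h} c → c < h → (b : FPS h) → (∀ m → b m ≡ diagⁿ c L m) →
  ∀ m → foldr _·_ b (concatMap (squared h) (upTo c)) m ≡ lhs h m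
telescope zero    _     b b≈ m = b≈ m
telescope {h} (suc c) c+1<h b b≈ m = begin
  foldr _·_ b (concatMap (squared h) (upTo (suc c))) m
    ≡⟨ cong (λ fs → foldr _·_ b fs m) factors ⟩
  foldr _·_ b (concatMap (squared h) (upTo c) ++ squared h c) m
    ≡⟨ cong (λ f → f m) (foldr-++ _·_ b (concatMap (squared h) (upTo c)) (squared h c)) ⟩
  foldr _·_ (foldr _·_ b (squared h c)) (concatMap (squared h) (upTo c)) m
    ≡⟨ telescope c (<-trans (n<1+n c) c+1<h) _ (squared-factor c c+1<h b b≈) m ⟩
  lhs h m ∎
  where
  factors : concatMap (squared h) (upTo (suc c)) ≡ concatMap (squared h) (upTo c) ++ squared h c
  factors = trans (cong (concatMap (squared h)) (sym (upTo-∷ʳ c))) (concatMap-++ (squared h) (upTo c) [ c ])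

lemma1 : (h : ℕ) → 1 ≤ h → (m : Exp h) → lhs h m ≡ rhs h m
lemma1 zero    ()
lemma1 (suc n) _ m = sym (telescope n (n<1+n n) base base≈ m)
  where
  base : FPS (suc n)
  base = mono (prefixOnes (suc n) (suc n)) · geom (prefixOnes (suc n) (suc n))
  base≈ : ∀ m → base m ≡ diagⁿ n L m
  base≈ m = trans (cong (λ v → (mono v · geom v) m) (prefixOnes≡prefix (suc n) (suc n))) (innermost n m)
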